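{- Let $k$ be a positive integer. If $H$ is a multigraph with feedback vertex number at most $k$ in which every vertex has degree at least $3$, and $B\subseteq V(H)$ is a $k$-significant subset of vertices of $H$, then the feedback vertex number of $H-B$ is at most $k-1$.
   Context: Multigraphs are undirected and may have parallel edges and self-loops; a self-loop contributes $2$ to the degree of its vertex; self-loops and pairs of parallel edges count as cycles; the feedback vertex number is the minimum size of a vertex set whose removal leaves an acyclic multigraph. A subset $B\subseteq V(H)$ is $k$-significant if $|B|\le 12k$ and $B$ contains every vertex of $H$ of degree at least $|E(H)|/(3k)$. -}

module Defs where

open import Data.Nat using (ℕ; zero; suc; _+_; _*_; _≤_)
open import Data.Fin using (Fin; zero; suc; inject₁; fromℕ; _≟_)
open import Data.Fin.Subset using (Subset; _∈_; _∉_; ∣_∣)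
open import Data.Product using (_×_; _,_; proj₁; proj₂; Σ; ∃; ∃-syntax)
open import Data.Sum using (_⊎_)
open import Relation.Binary.PropositionalEquality using (_≡_)
open import Relation.Nullary using (¬_; yes; no)
open import Function.Definitions using (Injective)

-- A finite multigraph with vertex set Fin n and m labelled edges;
-- edge e has endpoints ends e (a pair (u , u) is a self-loop).
record Multigraph (n m : ℕ) : Set where
  field
    ends : Fin m → Fin n × Fin n
open Multigraph public

ΣFin : ∀ {m} → (Fin m → ℕ) → ℕ
ΣFin {zero}  f = 0
ΣFin {suc m} f = f zero + ΣFin (λ i → f (suc i))

[_≡ᵥ_] : ∀ {n} → Fin n → Fin n → ℕ
[ u ≡ᵥ v ] with u ≟ v
... | yes _ = 1
... | no  _ = 0

-- degree: number of edge endpoints at v (a self-loop contributes 2)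
degree : ∀ {n m} → Multigraph n m → Fin n → ℕ
degree H v = ΣFin (λ e → [ proj₁ (ends H e) ≡ᵥ v ] + [ proj₂ (ends H e) ≡ᵥ v ])

Joins : ∀ {n m} → Multigraph n m → Fin m → Fin n → Fin n → Set
Joins H e a b = (proj₁ (ends H e) ≡ a × proj₂ (ends H e) ≡ b)
              ⊎ (proj₁ (ends H e) ≡ b × proj₂ (ends H e) ≡ a)

-- A cycle of length suc ℓ: distinct vertices vs 0 , … , vs ℓ and distinct
-- edges es 0 , … , es ℓ, where es i joins vs i and vs (i+1), and es ℓ joins
-- vs ℓ and vs 0.  Length 1 = self-loop; length 2 = two parallel edges.
record Cycle {n m} (H : Multigraph n m) : Set where
  field
    ℓ     : ℕ
    vs    : Fin (suc ℓ) → Fin n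
    es    : Fin (suc ℓ) → Fin m
    vs-inj : Injective _≡_ _≡_ vs
    es-inj : Injective _≡_ _≡_ es
    step  : (i : Fin ℓ) → Joins H (es (inject₁ i)) (vs (inject₁ i)) (vs (suc i))
    close : Joins H (es (fromℕ ℓ)) (vs (fromℕ ℓ)) (vs zero)
open Cycle public

AcyclicWithout : ∀ {n m} → Multigraph n m → Subset n → Set
AcyclicWithout H S = ¬ (Σ (Cycle H) λ C → ∀ i → vs C i ∉ S)

FVNWithoutAtMost : ∀ {n m} → Multigraph n m → Subset n → ℕ → Set
FVNWithoutAtMost {n} H B k =
  ∃[ S ] (∣ S ∣ ≤ k × (∀ v → v ∈ S → v ∉ B)
         × ¬ (Σ (Cycle H) λ C → ∀ i → vs C i ∉ S × vs C i ∉ B))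

FVNAtMost : ∀ {n m} → Multigraph n m → ℕ → Set
FVNAtMost H k = ∃[ S ] (∣ S ∣ ≤ k × AcyclicWithout H S)

-- B is k-significant: |B| ≤ 12k and every vertex of degree ≥ |E(H)|/(3k)
-- (i.e. 3k·deg v ≥ m) lies in B
Significant : ∀ {n m} → Multigraph n m → ℕ → Subset n → Set
Significant {n} {m} H k B =
  ∣ B ∣ ≤ 12 * k × (∀ v → m ≤ 3 * k * degree H v → v ∈ B)

module Submission where

-- Let X be a feedback vertex set with |X| ≤ k. If X meets B, then X ∖ B does
-- the job in H − B. Otherwise every vertex of X has degree below m/(3k), where
-- m = |E(H)|, so its volume (degree sum) satisfies 3k·vol X + |X| ≤ m·|X| ≤ m·k.
-- On the other hand H − X is a forest, so it has at most as many edges as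
-- vertices, and each of its vertices has degree at least 3; counting edge ends
-- gives m + vol(V ∖ X) ≤ 2·vol X + 3·|E(H − X)| ≤ 2·vol X + vol(V ∖ X), so
-- m ≤ 2·vol X. Together, 3k·vol X + |X| ≤ 2k·vol X, which forces X = ∅.

open import Data.Bool using (Bool; true; false; not; _∧_)
open import Data.Bool.Properties using (∧-conicalˡ; ∧-conicalʳ)
open import Data.Fin using (Fin; zero; suc; toℕ)
open import Data.Fin.Properties using (any?)
import Data.Fin.Properties as Fin
open import Data.Fin.Relation.Unary.Top using (view; ‵fromℕ; ‵inject₁)
open import Data.Fin.Subset using (Subset; _∈_; _∉_; ∣_∣; inside; outside; ∁; _∩_; _─_; _-_; ⁅_⁆)
open import Data.Fin.Subset.Properties
  using ( _∈?_; nonempty?; Empty-unique; x∈∁p⇒x∉p; x∈p∩q⁺; p─q⊆p; x∈p∧x∉q⇒x∈p─q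
        ; x∈p∧x≢y⇒x∈p-y; x∉⁅y⁆⇒x≢y; ∣⊥∣≡0; ∣⁅x⁆∣≡1; ∣p─q∣≤∣p∣; p∩q≢∅⇒∣p─q∣<∣p∣; x∈p⇒∣p-x∣<∣p∣)
open import Data.Nat using (ℕ; zero; suc; _+_; _*_; _∸_; _≤_; _<_; z≤n; s≤s; s≤s⁻¹)
open import Data.Nat.Induction using (<-wellFounded)
open import Data.Nat.Properties
open import Data.Nat.Solver using (module +-*-Solver)
open import Algebra.Properties.Semiring.Sum +-*-semiring
  using (sum; sum-cong-≗; sum-replicate-zero; ∑-distrib-+; ∑-comm; *-distribˡ-sum)
open import Data.Product using (Σ; _×_; _,_; proj₁; proj₂; ∃; ∃₂; ∃-syntax)
open import Data.Sum using (_⊎_; inj₁; inj₂)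
open import Data.Vec using ([]; _∷_; lookup; tabulate; there)
open import Data.Vec.Properties using (lookup∘tabulate; lookup-map; []=⇒lookup; lookup⇒[]=)
open import Function using (_∘_)
open import Induction.WellFounded using (Acc; acc)
open import Relation.Binary.Definitions using (tri<; tri≈; tri>)
open import Relation.Binary.PropositionalEquality
open import Relation.Nullary using (¬_; ¬?; Dec; yes; no; contradiction; _⊎-dec_; _×-dec_)
open import Relation.Unary using (Pred; Decidable)

open import Defs

𝟙 : Bool → ℕ
𝟙 true  = 1
𝟙 false = 0

χ : ∀ {n} → Subset n → Fin n → ℕ
χ p i = 𝟙 (lookup p i)

sum-mono-≤ : ∀ {n} {f g : Fin n → ℕ} → (∀ i → f i ≤ g i) → sum f ≤ sum g
sum-mono-≤ {zero}  f≤g = z≤n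
sum-mono-≤ {suc n} f≤g = +-mono-≤ (f≤g zero) (sum-mono-≤ (f≤g ∘ suc))

sum-const : ∀ n c → sum {n} (λ _ → c) ≡ n * c
sum-const zero    c = refl
sum-const (suc n) c = cong (c +_) (sum-const n c)

sum-supported-at : ∀ {n} {f : Fin n → ℕ} (u : Fin n) → (∀ v → v ≢ u → f v ≡ 0) → sum f ≡ f u
sum-supported-at {suc n} {f} zero f≡0 = begin
  f zero + sum (λ v → f (suc v)) ≡⟨ cong (f zero +_) (sum-cong-≗ λ v → f≡0 (suc v) λ ()) ⟩
  f zero + sum {n} (λ _ → 0)     ≡⟨ cong (f zero +_) (sum-replicate-zero n) ⟩
  f zero + 0                     ≡⟨ +-identityʳ (f zero) ⟩
  f zero                         ∎
  where open ≡-Reasoning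
sum-supported-at {suc n} {f} (suc u) f≡0 =
  trans (cong (_+ sum (λ v → f (suc v))) (f≡0 zero λ ()))
        (sum-supported-at u λ v v≢u → f≡0 (suc v) (v≢u ∘ Fin.suc-injective))

ΣFin≡sum : ∀ {n} (f : Fin n → ℕ) → ΣFin f ≡ sum f
ΣFin≡sum {zero}  f = refl
ΣFin≡sum {suc n} f = cong (f zero +_) (ΣFin≡sum (f ∘ suc))

[≡ᵥ]-refl : ∀ {n} (u : Fin n) → [ u ≡ᵥ u ] ≡ 1
[≡ᵥ]-refl u with u Fin.≟ u
... | yes _   = refl
... | no  u≢u = contradiction refl u≢u

[≡ᵥ]-≢ : ∀ {n} {u v : Fin n} → u ≢ v → [ u ≡ᵥ v ] ≡ 0
[≡ᵥ]-≢ {u = u} {v} u≢v with u Fin.≟ v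
... | yes u≡v = contradiction u≡v u≢v
... | no  _   = refl

sum-δ : ∀ {n} (g : Fin n → ℕ) u → sum (λ v → g v * [ u ≡ᵥ v ]) ≡ g u
sum-δ g u = begin
  sum (λ v → g v * [ u ≡ᵥ v ]) ≡⟨ sum-supported-at u vanishes ⟩
  g u * [ u ≡ᵥ u ]             ≡⟨ cong (g u *_) ([≡ᵥ]-refl u) ⟩
  g u * 1                      ≡⟨ *-identityʳ (g u) ⟩
  g u                          ∎
  where
  open ≡-Reasoning
  vanishes : ∀ v → v ≢ u → g v * [ u ≡ᵥ v ] ≡ 0
  vanishes v v≢u = trans (cong (g v *_) ([≡ᵥ]-≢ (v≢u ∘ sym))) (*-zeroʳ (g v))

∣p∣≡sum-χ : ∀ {n} (p : Subset n) → ∣ p ∣ ≡ sum (χ p)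
∣p∣≡sum-χ []            = refl
∣p∣≡sum-χ (inside  ∷ p) = cong suc (∣p∣≡sum-χ p)
∣p∣≡sum-χ (outside ∷ p) = ∣p∣≡sum-χ p

x∈p─q⇒x∉q : ∀ {n} {x : Fin n} (p q : Subset n) → x ∈ p ─ q → x ∉ q
x∈p─q⇒x∉q (_ ∷ p) (outside ∷ q) (there x∈p─q) (there x∈q) = x∈p─q⇒x∉q p q x∈p─q x∈q
x∈p─q⇒x∉q (_ ∷ p) (inside  ∷ q) (there x∈p─q) (there x∈q) = x∈p─q⇒x∉q p q x∈p─q x∈q

∣p∣≤∣p─q∣+∣q∣ : ∀ {n} (p q : Subset n) → ∣ p ∣ ≤ ∣ p ─ q ∣ + ∣ q ∣
∣p∣≤∣p─q∣+∣q∣ []            []            = z≤n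
∣p∣≤∣p─q∣+∣q∣ (inside  ∷ p) (outside ∷ q) = s≤s (∣p∣≤∣p─q∣+∣q∣ p q)
∣p∣≤∣p─q∣+∣q∣ (outside ∷ p) (outside ∷ q) = ∣p∣≤∣p─q∣+∣q∣ p q
∣p∣≤∣p─q∣+∣q∣ (inside  ∷ p) (inside  ∷ q) =
  subst (suc ∣ p ∣ ≤_) (sym (+-suc ∣ p ─ q ∣ ∣ q ∣)) (s≤s (∣p∣≤∣p─q∣+∣q∣ p q))
∣p∣≤∣p─q∣+∣q∣ (outside ∷ p) (inside  ∷ q) =
  ≤-trans (∣p∣≤∣p─q∣+∣q∣ p q) (+-monoʳ-≤ ∣ p ─ q ∣ (n≤1+n ∣ q ∣))

∣p∣≤1+∣p-x∣ : ∀ {n} (p : Subset n) x → ∣ p ∣ ≤ suc ∣ p - x ∣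
∣p∣≤1+∣p-x∣ p x = begin
  ∣ p ∣                 ≤⟨ ∣p∣≤∣p─q∣+∣q∣ p ⁅ x ⁆ ⟩
  ∣ p - x ∣ + ∣ ⁅ x ⁆ ∣ ≡⟨ cong (∣ p - x ∣ +_) (∣⁅x⁆∣≡1 x) ⟩
  ∣ p - x ∣ + 1         ≡⟨ +-comm ∣ p - x ∣ 1 ⟩
  suc ∣ p - x ∣         ∎
  where open ≤-Reasoning

least-witness : ∀ {p} {P : Pred ℕ p} → Decidable P → ∀ {j} → P j →
                ∃[ j′ ] (P j′ × ∀ {i} → i < j′ → ¬ P i)
least-witness {P = P} P? {j} Pj = go j Pj (<-wellFounded j)
  where
  go : ∀ j → P j → Acc _<_ j → ∃[ j′ ] (P j′ × ∀ {i} → i < j′ → ¬ P i)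
  go j Pj (acc rec) with anyUpTo? P? j
  ... | yes (i , i<j , Pi) = go i Pi (rec i<j)
  ... | no  none           = j , Pj , λ i<j Pi → none (_ , i<j , Pi)

first-return : ∀ {n} (w : ℕ → Fin n) →
  ∃₂ λ i ℓ → w (suc ℓ + i) ≡ w i × (∀ {x y} → x ≤ ℓ → y ≤ ℓ → w (x + i) ≡ w (y + i) → x ≡ y)
first-return {n} w = from-least (least-witness repeats? (proj₂ repetition))
  where
  Repeats : ℕ → Set
  Repeats j = ∃[ i ] (i < j × w i ≡ w j)

  repeats? : Decidable Repeats
  repeats? j = anyUpTo? (λ i → w i Fin.≟ w j) j

  repetition : ∃ Repeats
  repetition with i , j , i<j , wi≡wj ← Fin.pigeonhole (n<1+n n) (w ∘ toℕ) = toℕ j , toℕ i , i<j , wi≡wj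

  from-least : ∃[ j ] (Repeats j × ∀ {t} → t < j → ¬ Repeats t) →
    ∃₂ λ i ℓ → w (suc ℓ + i) ≡ w i × (∀ {x y} → x ≤ ℓ → y ≤ ℓ → w (x + i) ≡ w (y + i) → x ≡ y)
  from-least (j , (i , i<j , wi≡wj) , earlier) with m≤n⇒∃[o]m+o≡n i<j
  ... | ℓ , refl = i , ℓ , trans (cong (w ∘ suc) (+-comm ℓ i)) (sym wi≡wj) , injective
    where
    injective-below : ∀ {x y} → x < j → y < j → w x ≡ w y → x ≡ y
    injective-below {x} {y} x<j y<j wx≡wy with <-cmp x y
    ... | tri< x<y _ _ = contradiction (x , x<y , wx≡wy) (earlier y<j)
    ... | tri≈ _ x≡y _ = x≡y
    ... | tri> _ _ y<x = contradiction (y , y<x , sym wx≡wy) (earlier x<j)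

    shifted-below : ∀ {x} → x ≤ ℓ → x + i < j
    shifted-below x≤ℓ = s≤s (≤-trans (+-monoˡ-≤ i x≤ℓ) (≤-reflexive (+-comm ℓ i)))

    injective : ∀ {x y} → x ≤ ℓ → y ≤ ℓ → w (x + i) ≡ w (y + i) → x ≡ y
    injective x≤ℓ y≤ℓ eq = +-cancelʳ-≡ i _ _ (injective-below (shifted-below x≤ℓ) (shifted-below y≤ℓ) eq)

module _ {n m} (H : Multigraph n m) where

  private variable
    a b c d : Fin n
    e       : Fin m
    D       : Subset m

  private
    p q : Fin m → Fin n
    p e = proj₁ (ends H e)
    q e = proj₂ (ends H e)

  Incident : Fin n → Fin m → Set
  Incident a e = proj₁ (ends H e) ≡ a ⊎ proj₂ (ends H e) ≡ a

  incident? : ∀ a e → Dec (Incident a e)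
  incident? a e = (proj₁ (ends H e) Fin.≟ a) ⊎-dec (proj₂ (ends H e) Fin.≟ a)

  joins⇒incident : Joins H e a b → Incident a e
  joins⇒incident (inj₁ (p≡a , _)) = inj₁ p≡a
  joins⇒incident (inj₂ (_ , q≡a)) = inj₂ q≡a

  joins-sym : Joins H e a b → Joins H e b a
  joins-sym (inj₁ ends≡) = inj₂ ends≡
  joins-sym (inj₂ ends≡) = inj₁ ends≡

  incident⇒joins : Incident a e → ∃[ b ] Joins H e a b
  incident⇒joins (inj₁ p≡a) = _ , inj₁ (p≡a , refl)
  incident⇒joins (inj₂ q≡a) = _ , inj₂ (refl , q≡a)

  joins-unique : Joins H e a b → Joins H e c d → (a ≡ c × b ≡ d) ⊎ (a ≡ d × b ≡ c)
  joins-unique (inj₁ (p≡a , q≡b)) (inj₁ (p≡c , q≡d)) = inj₁ (trans (sym p≡a) p≡c , trans (sym q≡b) q≡d)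
  joins-unique (inj₁ (p≡a , q≡b)) (inj₂ (p≡d , q≡c)) = inj₂ (trans (sym p≡a) p≡d , trans (sym q≡b) q≡c)
  joins-unique (inj₂ (p≡b , q≡a)) (inj₁ (p≡c , q≡d)) = inj₂ (trans (sym q≡a) q≡d , trans (sym p≡b) p≡c)
  joins-unique (inj₂ (p≡b , q≡a)) (inj₂ (p≡d , q≡c)) = inj₁ (trans (sym q≡a) q≡c , trans (sym p≡b) p≡d)

  cycle-vertex-incident : (C : Cycle H) (i : Fin (suc (ℓ C))) → Incident (vs C i) (es C i)
  cycle-vertex-incident C i with view i
  ... | ‵fromℕ     = joins⇒incident (close C)
  ... | ‵inject₁ j = joins⇒incident (step C j)

  CycleIn : Subset m → Set
  CycleIn D = Σ (Cycle H) λ C → ∀ i → es C i ∈ D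

  EndsIn : Subset m → Subset n → Set
  EndsIn D A = ∀ {a e} → e ∈ D → Incident a e → a ∈ A

  record NonBacktrackingWalk (D : Subset m) : Set where
    field
      vertex       : ℕ → Fin n
      edge         : ℕ → Fin m
      edge∈D       : ∀ t → edge t ∈ D
      joins        : ∀ t → Joins H (edge t) (vertex t) (vertex (suc t))
      no-backtrack : ∀ t → edge (suc t) ≢ edge t
  open NonBacktrackingWalk

  drop : ℕ → NonBacktrackingWalk D → NonBacktrackingWalk D
  drop i W = record
    { vertex       = λ t → vertex W (t + i)
    ; edge         = λ t → edge W (t + i)
    ; edge∈D       = λ t → edge∈D W (t + i)
    ; joins        = λ t → joins W (t + i)
    ; no-backtrack = λ t → no-backtrack W (t + i)
    }

  closed-walk⇒cycle : (W : NonBacktrackingWalk D) (ℓ : ℕ) → vertex W (suc ℓ) ≡ vertex W 0 →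
    (∀ {x y} → x ≤ ℓ → y ≤ ℓ → vertex W x ≡ vertex W y → x ≡ y) → CycleIn D
  closed-walk⇒cycle W ℓ closes injective = cycle , λ i → edge∈D W (toℕ i)
    where
    w = vertex W
    f = edge W

    returns : ∀ {x y} → x ≤ ℓ → y ≤ suc ℓ → w x ≡ w y → x ≡ y ⊎ (x ≡ 0 × y ≡ suc ℓ)
    returns x≤ℓ y≤1+ℓ wx≡wy with m≤n⇒m<n∨m≡n y≤1+ℓ
    ... | inj₁ y<1+ℓ = inj₁ (injective x≤ℓ (s≤s⁻¹ y<1+ℓ) wx≡wy)
    ... | inj₂ refl  = inj₂ (injective x≤ℓ z≤n (trans wx≡wy closes) , refl)

    -- Equal edges f x = f y force y = x + 1 and a closed walk of length 2,
    -- which is backtracking.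
    edges-distinct : ∀ {x y} → x < y → y ≤ ℓ → f x ≢ f y
    edges-distinct {x} {y} x<y y≤ℓ fx≡fy
      with joins-unique (joins W x) (subst (λ e → Joins H e (w y) (w (suc y))) (sym fx≡fy) (joins W y))
    ... | inj₁ (wx≡wy , _) = <⇒≢ x<y (injective (<⇒≤ (<-≤-trans x<y y≤ℓ)) y≤ℓ wx≡wy)
    ... | inj₂ (wx≡w1+y , w1+x≡wy) with injective (≤-trans x<y y≤ℓ) y≤ℓ w1+x≡wy
    ...   | refl with returns (<⇒≤ (<-≤-trans x<y y≤ℓ)) (s≤s y≤ℓ) wx≡w1+y
    ...     | inj₁ x≡2+x      = <⇒≢ (m<n⇒m<1+n (n<1+n x)) x≡2+x
    ...     | inj₂ (refl , _) = no-backtrack W 0 (sym fx≡fy)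

    bound : ∀ (t : Fin (suc ℓ)) → toℕ t ≤ ℓ
    bound = Fin.toℕ≤pred[n]

    edges-injective : ∀ {s t : Fin (suc ℓ)} → f (toℕ s) ≡ f (toℕ t) → s ≡ t
    edges-injective {s} {t} eq with <-cmp (toℕ s) (toℕ t)
    ... | tri< s<t _ _ = contradiction eq (edges-distinct s<t (bound t))
    ... | tri≈ _ s≡t _ = Fin.toℕ-injective s≡t
    ... | tri> _ _ t<s = contradiction (sym eq) (edges-distinct t<s (bound s))

    cycle : Cycle H
    cycle = record
      { ℓ      = ℓ
      ; vs     = w ∘ toℕ
      ; es     = f ∘ toℕ
      ; vs-inj = λ eq → Fin.toℕ-injective (injective (bound _) (bound _) eq)
      ; es-inj = edges-injective
      ; step   = λ i → subst (λ t → Joins H (f t) (w t) (w (suc (toℕ i))))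
                             (sym (Fin.toℕ-inject₁ i)) (joins W (toℕ i))
      ; close  = subst (λ t → Joins H (f t) (w t) (w 0))
                       (sym (Fin.toℕ-fromℕ ℓ)) (subst (Joins H (f ℓ) (w ℓ)) closes (joins W ℓ))
      }

  walk⇒cycle : NonBacktrackingWalk D → CycleIn D
  walk⇒cycle W with i , ℓ , closes , injective ← first-return (vertex W) =
    closed-walk⇒cycle (drop i W) ℓ closes injective

  OtherEdge : Subset m → Fin n → Fin m → Set
  OtherEdge D a e = ∃[ e′ ] (e′ ∈ D × e′ ≢ e × Incident a e′)

  other-edge? : ∀ D a e → Dec (OtherEdge D a e)
  other-edge? D a e = any? λ e′ → e′ ∈? D ×-dec ¬? (e′ Fin.≟ e) ×-dec incident? a e′

  Continues : Subset m → Set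
  Continues D = ∀ {a e} → e ∈ D → Incident a e → OtherEdge D a e

  continuing-walk : Continues D → e ∈ D → NonBacktrackingWalk D
  continuing-walk {D} {e₀} continues e₀∈D = record
    { vertex       = Dart.tail ∘ darts
    ; edge         = Dart.arc ∘ darts
    ; edge∈D       = Dart.arc∈D ∘ darts
    ; joins        = Dart.joins ∘ darts
    ; no-backtrack = proj₂ ∘ advance ∘ darts
    }
    where
    record Dart : Set where
      field
        tail head : Fin n
        arc       : Fin m
        arc∈D     : arc ∈ D
        joins     : Joins H arc tail head

    -- The next dart starts where the current one ends, definitionally; this
    -- is what makes the field joins of the walk typecheck.
    advance : (d : Dart) → Σ Dart λ d′ → Dart.arc d′ ≢ Dart.arc d
    advance d =
      let e′ , e′∈D , e′≢e , incident = continues (Dart.arc∈D d) (joins⇒incident (joins-sym (Dart.joins d)))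
          b , joins′ = incident⇒joins incident
      in record { tail = Dart.head d ; head = b ; arc = e′ ; arc∈D = e′∈D ; joins = joins′ } , e′≢e

    darts : ℕ → Dart
    darts zero    = record { arc = e₀ ; arc∈D = e₀∈D ; joins = inj₁ (refl , refl) }
    darts (suc t) = proj₁ (advance (darts t))

  Pendant : Subset m → Fin n → Fin m → Set
  Pendant D a e = e ∈ D × Incident a e × ¬ OtherEdge D a e

  pendant? : ∀ D → Dec (∃₂ (Pendant D))
  pendant? D = any? λ a → any? λ e → e ∈? D ×-dec incident? a e ×-dec ¬? (other-edge? D a e)

  ¬pendant⇒continues : ¬ ∃₂ (Pendant D) → Continues D
  ¬pendant⇒continues {D} none {a} {e} e∈D incident with other-edge? D a e
  ... | yes other  = other
  ... | no  ¬other = contradiction (a , e , e∈D , incident , ¬other) none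

  -- Peel off pendant edges; once none is left, a non-backtracking walk closes a cycle.
  acyclic⇒∣edges∣≤∣vertices∣ : ∀ {A} → EndsIn D A → ¬ CycleIn D → ∣ D ∣ ≤ ∣ A ∣
  acyclic⇒∣edges∣≤∣vertices∣ {D} ends acyclic = go ends acyclic (<-wellFounded ∣ D ∣)
    where
    go : ∀ {D A} → EndsIn D A → ¬ CycleIn D → Acc _<_ ∣ D ∣ → ∣ D ∣ ≤ ∣ A ∣
    go {D} {A} ends acyclic (acc rec) with pendant? D
    ... | yes (a , e , e∈D , incident , alone) = begin
      ∣ D ∣         ≤⟨ ∣p∣≤1+∣p-x∣ D e ⟩
      suc ∣ D - e ∣ ≤⟨ s≤s (go ends′ acyclic′ (rec (x∈p⇒∣p-x∣<∣p∣ e∈D))) ⟩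
      suc ∣ A - a ∣ ≤⟨ x∈p⇒∣p-x∣<∣p∣ (ends e∈D incident) ⟩
      ∣ A ∣         ∎
      where
      open ≤-Reasoning

      ends′ : EndsIn (D - e) (A - a)
      ends′ {b} {e′} e′∈D-e incident′ = x∈p∧x≢y⇒x∈p-y (ends e′∈D incident′) b≢a
        where
        e′∈D = p─q⊆p D ⁅ e ⁆ e′∈D-e
        b≢a : b ≢ a
        b≢a refl = alone (e′ , e′∈D , x∉⁅y⁆⇒x≢y (x∈p─q⇒x∉q D ⁅ e ⁆ e′∈D-e) , incident′)

      acyclic′ : ¬ CycleIn (D - e)
      acyclic′ (C , es∈D-e) = acyclic (C , p─q⊆p D ⁅ e ⁆ ∘ es∈D-e)
    ... | no none with nonempty? D
    ...   | yes (e , e∈D) = contradiction (walk⇒cycle (continuing-walk (¬pendant⇒continues none) e∈D)) acyclic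
    ...   | no empty      = subst (_≤ ∣ A ∣) (sym (trans (cong ∣_∣ (Empty-unique empty)) (∣⊥∣≡0 m))) z≤n

  sum-weighted-degree : ∀ (g : Fin n → ℕ) → sum (λ v → g v * degree H v) ≡ sum (λ e → g (p e) + g (q e))
  sum-weighted-degree g = begin
    sum (λ v → g v * degree H v)
      ≡⟨ sum-cong-≗ (λ v → cong (g v *_) (ΣFin≡sum (incidences v))) ⟩
    sum (λ v → g v * sum (incidences v))
      ≡⟨ sum-cong-≗ (λ v → *-distribˡ-sum (g v) (incidences v)) ⟩
    sum (λ v → sum (λ e → g v * incidences v e))
      ≡⟨ ∑-comm (λ v e → g v * incidences v e) ⟩
    sum (λ e → sum (λ v → g v * incidences v e))
      ≡⟨ sum-cong-≗ endpoints ⟩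
    sum (λ e → g (p e) + g (q e)) ∎
    where
    open ≡-Reasoning
    incidences : Fin n → Fin m → ℕ
    incidences v e = [ p e ≡ᵥ v ] + [ q e ≡ᵥ v ]

    endpoints : ∀ e → sum (λ v → g v * incidences v e) ≡ g (p e) + g (q e)
    endpoints e = begin
      sum (λ v → g v * ([ p e ≡ᵥ v ] + [ q e ≡ᵥ v ]))
        ≡⟨ sum-cong-≗ (λ v → *-distribˡ-+ (g v) [ p e ≡ᵥ v ] [ q e ≡ᵥ v ]) ⟩
      sum (λ v → g v * [ p e ≡ᵥ v ] + g v * [ q e ≡ᵥ v ])
        ≡⟨ ∑-distrib-+ (λ v → g v * [ p e ≡ᵥ v ]) (λ v → g v * [ q e ≡ᵥ v ]) ⟩
      sum (λ v → g v * [ p e ≡ᵥ v ]) + sum (λ v → g v * [ q e ≡ᵥ v ])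
        ≡⟨ cong₂ _+_ (sum-δ g (p e)) (sum-δ g (q e)) ⟩
      g (p e) + g (q e) ∎

  volume : Subset n → ℕ
  volume X = sum (λ v → χ X v * degree H v)

  min-degree⇒d*∣A∣≤volume : ∀ {d} → (∀ v → d ≤ degree H v) → ∀ A → d * ∣ A ∣ ≤ volume A
  min-degree⇒d*∣A∣≤volume {d} d≤deg A = begin
    d * ∣ A ∣              ≡⟨ cong (d *_) (∣p∣≡sum-χ A) ⟩
    d * sum (χ A)          ≡⟨ *-distribˡ-sum d (χ A) ⟩
    sum (λ v → d * χ A v) ≤⟨ sum-mono-≤ (λ v → ≤-trans (≤-reflexive (*-comm d (χ A v))) (*-monoʳ-≤ (χ A v) (d≤deg v))) ⟩
    volume A               ∎
    where open ≤-Reasoning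

  edgesWithin : Subset n → Subset m
  edgesWithin A = tabulate (λ e → lookup A (p e) ∧ lookup A (q e))

  ∈edgesWithin⁻ : ∀ {A} → e ∈ edgesWithin A → lookup A (p e) ∧ lookup A (q e) ≡ true
  ∈edgesWithin⁻ {e} {A} e∈F =
    trans (sym (lookup∘tabulate (λ e → lookup A (p e) ∧ lookup A (q e)) e)) ([]=⇒lookup e∈F)

  edgesWithin-ends : ∀ {A} → EndsIn (edgesWithin A) A
  edgesWithin-ends {A} {e = e} e∈F (inj₁ refl) = lookup⇒[]= (p e) A (∧-conicalˡ _ _ (∈edgesWithin⁻ {A = A} e∈F))
  edgesWithin-ends {A} {e = e} e∈F (inj₂ refl) = lookup⇒[]= (q e) A (∧-conicalʳ _ _ (∈edgesWithin⁻ {A = A} e∈F))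

  edge-budget : ∀ X → m + volume (∁ X) ≤ 2 * volume X + 3 * ∣ edgesWithin (∁ X) ∣
  edge-budget X = begin
    m + volume A
      ≡⟨ cong₂ _+_ (sym (trans (sum-const m 1) (*-identityʳ m))) (sum-weighted-degree (χ A)) ⟩
    sum {m} (λ _ → 1) + sum (λ e → χ A (p e) + χ A (q e))
      ≡⟨ sym (∑-distrib-+ {m} (λ _ → 1) (λ e → χ A (p e) + χ A (q e))) ⟩
    sum (λ e → 1 + (χ A (p e) + χ A (q e)))
      ≤⟨ sum-mono-≤ per-edge ⟩
    sum (λ e → 2 * (χ X (p e) + χ X (q e)) + 3 * χ F e)
      ≡⟨ ∑-distrib-+ (λ e → 2 * (χ X (p e) + χ X (q e))) (λ e → 3 * χ F e) ⟩
    sum (λ e → 2 * (χ X (p e) + χ X (q e))) + sum (λ e → 3 * χ F e)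
      ≡⟨ cong₂ _+_ (sym (*-distribˡ-sum 2 (λ e → χ X (p e) + χ X (q e)))) (sym (*-distribˡ-sum 3 (χ F))) ⟩
    2 * sum (λ e → χ X (p e) + χ X (q e)) + 3 * sum (χ F)
      ≡⟨ cong₂ _+_ (cong (2 *_) (sym (sum-weighted-degree (χ X)))) (cong (3 *_) (sym (∣p∣≡sum-χ F))) ⟩
    2 * volume X + 3 * ∣ F ∣ ∎
    where
    open ≤-Reasoning
    A = ∁ X
    F = edgesWithin A

    -- An edge pays for itself and for its endpoints outside X with two tokens
    -- per endpoint in X, or with three tokens if both endpoints lie outside X.
    edge-tokens : ∀ x y → 1 + (𝟙 (not x) + 𝟙 (not y)) ≤ 2 * (𝟙 x + 𝟙 y) + 3 * 𝟙 (not x ∧ not y)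
    edge-tokens true  true  = s≤s z≤n
    edge-tokens true  false = s≤s (s≤s z≤n)
    edge-tokens false true  = s≤s (s≤s z≤n)
    edge-tokens false false = ≤-refl

    per-edge : ∀ e → 1 + (χ A (p e) + χ A (q e)) ≤ 2 * (χ X (p e) + χ X (q e)) + 3 * χ F e
    per-edge e rewrite lookup∘tabulate (λ e → lookup A (p e) ∧ lookup A (q e)) e
                     | lookup-map (p e) not X | lookup-map (q e) not X =
      edge-tokens (lookup X (p e)) (lookup X (q e))

  feedback-set⇒m≤2*volume : ∀ {X} → AcyclicWithout H X → (∀ v → 3 ≤ degree H v) → m ≤ 2 * volume X
  feedback-set⇒m≤2*volume {X} acyclic 3≤deg = +-cancelʳ-≤ (volume A) m (2 * volume X) (begin
    m + volume A             ≤⟨ edge-budget X ⟩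
    2 * volume X + 3 * ∣ F ∣ ≤⟨ +-monoʳ-≤ (2 * volume X) (*-monoʳ-≤ 3 forest) ⟩
    2 * volume X + 3 * ∣ A ∣ ≤⟨ +-monoʳ-≤ (2 * volume X) (min-degree⇒d*∣A∣≤volume 3≤deg A) ⟩
    2 * volume X + volume A  ∎)
    where
    open ≤-Reasoning
    A = ∁ X
    F = edgesWithin A

    forest : ∣ F ∣ ≤ ∣ A ∣
    forest = acyclic⇒∣edges∣≤∣vertices∣ (edgesWithin-ends {A}) λ (C , es∈F) →
      acyclic (C , λ i → x∈∁p⇒x∉p (edgesWithin-ends {A} (es∈F i) (cycle-vertex-incident C i)))

  light-set⇒c*volume+∣X∣≤m*∣X∣ : ∀ c {X} → (∀ v → v ∈ X → c * degree H v < m) → c * volume X + ∣ X ∣ ≤ m * ∣ X ∣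
  light-set⇒c*volume+∣X∣≤m*∣X∣ c {X} light = begin
    c * volume X + ∣ X ∣
      ≡⟨ cong₂ _+_ (*-distribˡ-sum c (λ v → χ X v * degree H v)) (∣p∣≡sum-χ X) ⟩
    sum (λ v → c * (χ X v * degree H v)) + sum (χ X)
      ≡⟨ sym (∑-distrib-+ (λ v → c * (χ X v * degree H v)) (χ X)) ⟩
    sum (λ v → c * (χ X v * degree H v) + χ X v)
      ≤⟨ sum-mono-≤ per-vertex ⟩
    sum (λ v → m * χ X v)
      ≡⟨ sym (*-distribˡ-sum m (χ X)) ⟩
    m * sum (χ X)
      ≡⟨ cong (m *_) (sym (∣p∣≡sum-χ X)) ⟩
    m * ∣ X ∣ ∎
    where
    open ≤-Reasoning
    per-vertex : ∀ v → c * (χ X v * degree H v) + χ X v ≤ m * χ X v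
    per-vertex v with lookup X v in v∈X
    ... | false = ≤-reflexive (trans (+-identityʳ (c * 0)) (trans (*-zeroʳ c) (sym (*-zeroʳ m))))
    ... | true  = begin
      c * (degree H v + 0) + 1 ≡⟨ cong (λ d → c * d + 1) (+-identityʳ (degree H v)) ⟩
      c * degree H v + 1       ≡⟨ +-comm (c * degree H v) 1 ⟩
      suc (c * degree H v)     ≤⟨ light v (lookup⇒[]= v X v∈X) ⟩
      m                        ≡⟨ *-identityʳ m ⟨
      m * 1                    ∎

3kV+s≤ms⇒s≡0 : ∀ k V s m → 3 * k * V + s ≤ m * s → s ≤ k → m ≤ 2 * V → s ≡ 0
3kV+s≤ms⇒s≡0 k V s m light s≤k m≤2V = n≤0⇒n≡0 (m+n≤o⇒n≤o (k * V) (+-cancelʳ-≤ (2 * V * k) (k * V + s) 0 (begin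
  k * V + s + 2 * V * k ≡⟨ solve 3 (λ k V s → k :* V :+ s :+ con 2 :* V :* k := con 3 :* k :* V :+ s) refl k V s ⟩
  3 * k * V + s         ≤⟨ light ⟩
  m * s                 ≤⟨ *-monoʳ-≤ m s≤k ⟩
  m * k                 ≤⟨ *-monoˡ-≤ k m≤2V ⟩
  2 * V * k             ∎)))
  where
  open ≤-Reasoning
  open +-*-Solver

corollary6p2 : (k : ℕ) → 1 ≤ k → ∀ {n m} (H : Multigraph n m) →
    FVNAtMost H k → (∀ v → 3 ≤ degree H v) →
    (B : Subset n) → Significant H k B →
    FVNWithoutAtMost H B (k ∸ 1)
corollary6p2 zero ()
corollary6p2 (suc k) _ {n} {m} H (X , ∣X∣≤1+k , acyclic) 3≤deg B (_ , heavy∈B) =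
  X ─ B , size , (λ _ → x∈p─q⇒x∉q X B) , acyclic′
  where
  acyclic′ : ¬ (Σ (Cycle H) λ C → ∀ i → vs C i ∉ X ─ B × vs C i ∉ B)
  acyclic′ (C , avoids) = acyclic (C , λ i v∈X → proj₁ (avoids i) (x∈p∧x∉q⇒x∈p─q v∈X (proj₂ (avoids i))))

  size : ∣ X ─ B ∣ ≤ k
  size with nonempty? (X ∩ B)
  ... | yes meets = s≤s⁻¹ (≤-trans (p∩q≢∅⇒∣p─q∣<∣p∣ X B meets) ∣X∣≤1+k)
  ... | no  misses = ≤-trans (∣p─q∣≤∣p∣ X B) (≤-trans (≤-reflexive ∣X∣≡0) z≤n)
    where
    light : ∀ v → v ∈ X → 3 * suc k * degree H v < m
    light v v∈X = ≰⇒> λ heavy → misses (v , x∈p∩q⁺ (v∈X , heavy∈B v heavy))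

    ∣X∣≡0 : ∣ X ∣ ≡ 0
    ∣X∣≡0 = 3kV+s≤ms⇒s≡0 (suc k) (volume H X) ∣ X ∣ m (light-set⇒c*volume+∣X∣≤m*∣X∣ H (3 * suc k) light) ∣X∣≤1+k
                    (feedback-set⇒m≤2*volume H acyclic 3≤deg)
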